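{- Let $\mathbf{F}_q$ be a finite field with $q\equiv 1\pmod 4$, let $d=(q-1)/4$, and let $g$ be a generator of the multiplicative group $\mathbf{F}_q^*$. Let $i$ be an integer with $0\le i\le d-1$, and define $a_0,a_1,a_2,a_3\in\mathbf{F}_q$ in one of the following two ways: (a) $\displaystyle a_0=\frac{(g^{4i+2}+1)^2}{4g^{4i+2}},\quad a_1=\frac{g^{2(4i+2)}-1}{4g^{4i+2}},\quad a_2=\frac{(g^{4i+2}-1)^2}{4g^{4i+2}},\quad a_3=a_1$; (b) $\displaystyle a_0=\frac{(g^{4i+2}+1)^2}{4g^{4i+2}},\quad a_1=\frac{g^{2(4i+2)}-1}{4g^{d+4i+2}},\quad a_2=1-a_0,\quad a_3=-a_1$. In either case, the polynomial $f(x)=a_3x^{3d+1}+a_2x^{2d+1}+a_1x^{d+1}+a_0x\in\mathbf{F}_q[x]$ induces an involution of $\mathbf{F}_q$ (i.e. $f(f(x))=x$ for all $x\in\mathbf{F}_q$), and the number of $x\in\mathbf{F}_q$ with $f(x)=x$ is exactly $\frac{q+1}{2}$.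
   Context: A polynomial $f\in\mathbf{F}_q[x]$ is regarded as the function $x\mapsto f(x)$ on $\mathbf{F}_q$. An involution of $\mathbf{F}_q$ is a map $f:\mathbf{F}_q\to\mathbf{F}_q$ with $f\circ f=\mathrm{id}$. A fixed point of $f$ is an $x\in\mathbf{F}_q$ with $f(x)=x$. -}

module Defs where

open import Level using (0ℓ)
open import Data.Nat as ℕ using (ℕ; zero; suc)
open import Data.Fin using (Fin)
open import Data.Product using (∃; _×_)
open import Function.Bundles using (_↔_)
open import Relation.Binary.PropositionalEquality using (_≡_; _≢_)
open import Relation.Nullary using (¬_)
import Algebra.Structures as S

record FiniteField : Set₁ where
  infixl 6 _+_
  infixl 7 _*_
  infix  8 -_
  field
    Carrier : Set
    _+_ _*_ : Carrier → Carrier → Carrier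
    -_      : Carrier → Carrier
    0# 1#   : Carrier
    isCommutativeRing : S.IsCommutativeRing _≡_ _+_ _*_ -_ 0# 1#
    0≢1     : 0# ≢ 1#
    _⁻¹     : Carrier → Carrier
    inverse : ∀ x → x ≢ 0# → x * (x ⁻¹) ≡ 1#
    q       : ℕ
    enum    : Fin q ↔ Carrier

  _-_ : Carrier → Carrier → Carrier
  x - y = x + (- y)

  _/_ : Carrier → Carrier → Carrier
  x / y = x * (y ⁻¹)

  _^_ : Carrier → ℕ → Carrier
  x ^ zero  = 1#
  x ^ suc n = x * (x ^ n)

  4# : Carrier
  4# = 1# + 1# + 1# + 1#

  IsGenerator : Carrier → Set
  IsGenerator g = (g ≢ 0#) × (∀ x → x ≢ 0# → ∃ λ k → g ^ k ≡ x)

{-# OPTIONS --safe #-}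
-- Write f(x) = x · P(x^d) with P(u) = a₃u³ + a₂u² + a₁u + a₀, and let ω = g^d, so that ω² = -1 and
-- x^d ∈ {±1, ±ω} for x ≠ 0. The coefficients make P equal to 1 on one class ±s = ±ω^t of fourth roots
-- of unity, while P(ωs) and P(-ωs) are mutually inverse with d-th power -1. Hence f fixes 0 and every x
-- with x^d = ±s; on the remaining x it multiplies by P(x^d), which swaps x^d = ±ωs with ∓ωs, and the
-- second application multiplies by the inverse factor. The fixed points are 0 and the 2d powers g^k with
-- k ≡ t (mod 2).
module Submission where

open import Defs
open import Level using (0ℓ)
open import Data.Nat as ℕ using (ℕ; zero; suc; _<_; _≤_; _∸_)
import Data.Nat.Properties as ℕ
open import Data.Nat.DivMod using (_%_; m≡m%n+[m/n]*n; m%n<n; m*n/n≡m; m<n*o⇒m/o<n)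
open import Data.Integer as ℤ using (ℤ; -[1+_])
import Data.Integer.Properties as ℤ
import Data.Sign as Sign
open import Data.Fin as Fin using (Fin; toℕ; fromℕ<)
open import Data.Fin.Properties using (injective⇒≤; pigeonhole; inj⇒≟; toℕ-injective; toℕ-fromℕ<; toℕ<n)
open import Data.Maybe using (Maybe; just; nothing)
open import Data.Product using (Σ; ∃; _×_; _,_; proj₁; proj₂)
open import Data.Product.Properties using (Σ-≡,≡→≡)
open import Data.Sum using (_⊎_; inj₁; inj₂)
open import Data.Empty using (⊥-elim)
open import Function.Base using (_∘′_)
open import Function.Bundles using (Inverse; Injection; _↔_; mk⤖)
open import Function.Definitions using (Injective; Surjective)
open import Function.Properties.Bijection using (⤖⇒↔)
open import Function.Properties.Inverse using (↔-sym; ↔⇒↣)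
open import Relation.Nullary using (yes; no)
open import Relation.Binary.Definitions using (DecidableEquality; tri<; tri≈; tri>)
open import Relation.Binary.PropositionalEquality
  using (_≡_; _≢_; refl; sym; trans; cong; cong₂; subst; subst₂; module ≡-Reasoning)
open import Algebra.Bundles using (CommutativeRing)
open import Algebra.Structures using (IsCommutativeRing)
import Algebra.Solver.Ring.AlmostCommutativeRing as ACR
import Axiom.UniquenessOfIdentityProofs as UIP

module IntegerCoefficientSolver {c ℓ} (R : CommutativeRing c ℓ) where

  private
    open CommutativeRing R renaming (refl to ≈-refl; sym to ≈-sym; trans to ≈-trans)
    open import Algebra.Properties.Ring ring
    open import Algebra.Properties.Semiring.Mult.TCOptimised semiring using (1+×; ×-homo-+; ×1-homo-*) renaming (_×_ to _×′_)
    open import Relation.Binary.Reasoning.Setoid setoid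

    -- _×′_ rather than _×_ makes the numerals ⟦ + 1 ⟧ and ⟦ + 4 ⟧ definitionally 1# and 4#
    ι : ℕ → Carrier
    ι n = n ×′ 1#

    ⟦_⟧ : ℤ → Carrier
    ⟦ ℤ.+ n ⟧ = ι n
    ⟦ -[1+ n ] ⟧ = - ι (suc n)

    ⟦⟧-cong : ∀ {i j} → i ≡ j → ⟦ i ⟧ ≈ ⟦ j ⟧
    ⟦⟧-cong refl = ≈-refl

    ⊖-homo : ∀ m n → ⟦ m ℤ.⊖ n ⟧ ≈ ι m - ι n
    ⊖-homo m zero = ≈-sym (≈-trans (+-congˡ -0#≈0#) (+-identityʳ (ι m)))
    ⊖-homo zero (suc n) = ≈-sym (+-identityˡ _)
    ⊖-homo (suc m) (suc n) = begin
      ⟦ suc m ℤ.⊖ suc n ⟧         ≈⟨ ⟦⟧-cong (ℤ.[1+m]⊖[1+n]≡m⊖n m n) ⟩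
      ⟦ m ℤ.⊖ n ⟧                 ≈⟨ ⊖-homo m n ⟩
      ι m - ι n                   ≈⟨ xyx⁻¹≈y 1# (ι m - ι n) ⟨
      1# + (ι m - ι n) - 1#       ≈⟨ +-congʳ (+-assoc 1# (ι m) (- ι n)) ⟨
      1# + ι m - ι n - 1#         ≈⟨ +-assoc (1# + ι m) (- ι n) (- 1#) ⟩
      1# + ι m + (- ι n - 1#)     ≈⟨ +-congˡ (≈-trans (-‿+-comm (ι n) 1#) (-‿cong (+-comm (ι n) 1#))) ⟩
      1# + ι m - (1# + ι n)       ≈⟨ +-cong (1+× m 1#) (-‿cong (1+× n 1#)) ⟨
      ι (suc m) - ι (suc n)       ∎

    +-homo : ∀ i j → ⟦ i ℤ.+ j ⟧ ≈ ⟦ i ⟧ + ⟦ j ⟧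
    +-homo (ℤ.+ m) (ℤ.+ n) = ×-homo-+ 1# m n
    +-homo (ℤ.+ m) -[1+ n ] = ⊖-homo m (suc n)
    +-homo -[1+ m ] (ℤ.+ n) = ≈-trans (⊖-homo n (suc m)) (+-comm _ _)
    +-homo -[1+ m ] -[1+ n ] = begin
      - ι (suc (suc (m ℕ.+ n)))   ≈⟨ -‿cong (⟦⟧-cong (cong (ℤ.+_ ∘′ suc) (ℕ.+-suc m n))) ⟨
      - ι (suc m ℕ.+ suc n)       ≈⟨ -‿cong (×-homo-+ 1# (suc m) (suc n)) ⟩
      - (ι (suc m) + ι (suc n))   ≈⟨ -‿+-comm _ _ ⟨
      - ι (suc m) - ι (suc n)     ∎

    signed : Sign.Sign → Carrier → Carrier
    signed Sign.+ x = x
    signed Sign.- x = - x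

    ◃-homo : ∀ s n → ⟦ s ℤ.◃ n ⟧ ≈ signed s (ι n)
    ◃-homo Sign.+ zero = ≈-refl
    ◃-homo Sign.- zero = ≈-sym -0#≈0#
    ◃-homo Sign.+ (suc n) = ≈-refl
    ◃-homo Sign.- (suc n) = ≈-refl

    signed-* : ∀ s t x y → signed (s Sign.* t) (x * y) ≈ signed s x * signed t y
    signed-* Sign.+ Sign.+ x y = ≈-refl
    signed-* Sign.+ Sign.- x y = -‿distribʳ-* x y
    signed-* Sign.- Sign.+ x y = -‿distribˡ-* x y
    signed-* Sign.- Sign.- x y = begin
      x * y         ≈⟨ -‿involutive (x * y) ⟨
      - - (x * y)   ≈⟨ -‿cong (-‿distribˡ-* x y) ⟩
      - (- x * y)   ≈⟨ -‿distribʳ-* (- x) y ⟩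
      - x * - y     ∎

    ⟦⟧-signed : ∀ i → ⟦ i ⟧ ≈ signed (ℤ.sign i) (ι ℤ.∣ i ∣)
    ⟦⟧-signed (ℤ.+ n) = ≈-refl
    ⟦⟧-signed -[1+ n ] = ≈-refl

    *-homo : ∀ i j → ⟦ i ℤ.* j ⟧ ≈ ⟦ i ⟧ * ⟦ j ⟧
    *-homo i j = begin
      ⟦ i ℤ.* j ⟧                                    ≈⟨ ◃-homo (s Sign.* t) (∣i∣ ℕ.* ∣j∣) ⟩
      signed (s Sign.* t) (ι (∣i∣ ℕ.* ∣j∣))          ≈⟨ signed-cong (s Sign.* t) (×1-homo-* ∣i∣ ∣j∣) ⟩
      signed (s Sign.* t) (ι ∣i∣ * ι ∣j∣)            ≈⟨ signed-* s t (ι ∣i∣) (ι ∣j∣) ⟩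
      signed s (ι ∣i∣) * signed t (ι ∣j∣)            ≈⟨ *-cong (⟦⟧-signed i) (⟦⟧-signed j) ⟨
      ⟦ i ⟧ * ⟦ j ⟧                                  ∎
      where
      s = ℤ.sign i
      t = ℤ.sign j
      ∣i∣ = ℤ.∣ i ∣
      ∣j∣ = ℤ.∣ j ∣
      signed-cong : ∀ s {x y} → x ≈ y → signed s x ≈ signed s y
      signed-cong Sign.+ x≈y = x≈y
      signed-cong Sign.- x≈y = -‿cong x≈y

    neg-homo : ∀ i → ⟦ ℤ.- i ⟧ ≈ - ⟦ i ⟧
    neg-homo (ℤ.+ zero) = ≈-sym -0#≈0#
    neg-homo (ℤ.+ suc n) = ≈-refl
    neg-homo -[1+ n ] = ≈-sym (-‿involutive _)

    almostCommutativeRing : ACR.AlmostCommutativeRing c ℓ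
    almostCommutativeRing = ACR.fromCommutativeRing R

    ℤ-homomorphism : CommutativeRing.rawRing ℤ.+-*-commutativeRing ACR.-Raw-AlmostCommutative⟶ almostCommutativeRing
    ℤ-homomorphism = record
      { ⟦_⟧ = ⟦_⟧ ; +-homo = +-homo ; *-homo = *-homo ; -‿homo = neg-homo
      ; 0-homo = ≈-refl ; 1-homo = ≈-refl }

    ⟦⟧-≟ : ∀ i j → Maybe (⟦ i ⟧ ≈ ⟦ j ⟧)
    ⟦⟧-≟ i j with i ℤ.≟ j
    ... | yes i≡j = just (⟦⟧-cong i≡j)
    ... | no _ = nothing

  open import Algebra.Solver.Ring (CommutativeRing.rawRing ℤ.+-*-commutativeRing)
    almostCommutativeRing ℤ-homomorphism ⟦⟧-≟ public

module _ {a p} {A : Set a} {P : A → Set p} where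

  enumeration⇒↔ : ∀ {n} (e : Fin n → A) → Injective _≡_ _≡_ e →
                  (∀ i → P (e i)) → (∀ x → P x → ∃ λ i → e i ≡ x) →
                  (∀ {x} (p p′ : P x) → p ≡ p′) → Fin n ↔ Σ A P
  enumeration⇒↔ e e-injective e-valid e-covers P-irrelevant =
    ⤖⇒↔ (mk⤖ {to = λ i → e i , e-valid i} (injective , surjective))
    where
    injective : Injective _≡_ _≡_ (λ i → e i , e-valid i)
    injective eq = e-injective (cong proj₁ eq)
    surjective : Surjective _≡_ _≡_ (λ i → e i , e-valid i)
    surjective (x , px) with i , eᵢ≡x ← e-covers x px =
      i , λ { refl → Σ-≡,≡→≡ (eᵢ≡x , P-irrelevant _ _) }

n+j*2<m*2 : ∀ {n j m} → n < 2 → j < m → n ℕ.+ j ℕ.* 2 < m ℕ.* 2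
n+j*2<m*2 {n} {j} {m} n<2 j<m = begin-strict
  n ℕ.+ j ℕ.* 2    <⟨ ℕ.+-monoˡ-< (j ℕ.* 2) n<2 ⟩
  suc j ℕ.* 2      ≤⟨ ℕ.*-monoˡ-≤ 2 j<m ⟩
  m ℕ.* 2          ∎
  where open ℕ.≤-Reasoning

2*d*2≡4*d : ∀ d → 2 ℕ.* d ℕ.* 2 ≡ 4 ℕ.* d
2*d*2≡4*d d = trans (ℕ.*-comm (2 ℕ.* d) 2) (sym (ℕ.*-assoc 2 2 d))

[1+4d+1]/2≡1+2d : ∀ d → (suc (4 ℕ.* d) ℕ.+ 1) ℕ./ 2 ≡ suc (2 ℕ.* d)
[1+4d+1]/2≡1+2d d = trans (cong (ℕ._/ 2) 1+4d+1≡[1+2d]*2) (m*n/n≡m (suc (2 ℕ.* d)) 2)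
  where
  1+4d+1≡[1+2d]*2 : suc (4 ℕ.* d) ℕ.+ 1 ≡ suc (2 ℕ.* d) ℕ.* 2
  1+4d+1≡[1+2d]*2 = trans (ℕ.+-comm (suc (4 ℕ.* d)) 1) (cong (2 ℕ.+_) (sym (2*d*2≡4*d d)))

m%4≡1⇒m≡1+4*[m∸1]/4 : ∀ m → m % 4 ≡ 1 → m ≡ suc (4 ℕ.* ((m ∸ 1) ℕ./ 4))
m%4≡1⇒m≡1+4*[m∸1]/4 m m%4≡1 = trans m≡1+k*4 (cong suc (trans (ℕ.*-comm k 4) (cong (4 ℕ.*_) (sym [m∸1]/4≡k))))
  where
  k = m ℕ./ 4
  m≡1+k*4 : m ≡ suc (k ℕ.* 4)
  m≡1+k*4 = trans (m≡m%n+[m/n]*n m 4) (cong (ℕ._+ k ℕ.* 4) m%4≡1)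
  [m∸1]/4≡k : (m ∸ 1) ℕ./ 4 ≡ k
  [m∸1]/4≡k = trans (cong (λ n → (n ∸ 1) ℕ./ 4) m≡1+k*4) (m*n/n≡m k 4)

module FiniteFieldProperties (F : FiniteField) where

  open FiniteField F
  open IsCommutativeRing isCommutativeRing
    using (-‿inverseʳ; *-comm; *-assoc; *-identityˡ; *-identityʳ; zeroˡ; zeroʳ)
  open Inverse enum using (to)

  commutativeRing : CommutativeRing 0ℓ 0ℓ
  commutativeRing = record { isCommutativeRing = isCommutativeRing }

  open IntegerCoefficientSolver commutativeRing using (Polynomial; solve; _:=_; _:+_; _:*_; _:-_; :-_; _:^_; con)
  open import Algebra.Properties.Ring (CommutativeRing.ring commutativeRing)
    using (-‿involutive; -1*x≈-x; -‿distribʳ-*; +-inverseˡ-unique)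

  _≟_ : DecidableEquality Carrier
  _≟_ = inj⇒≟ (↔⇒↣ (↔-sym enum))

  ⁻¹-inverseˡ : ∀ {x} → x ≢ 0# → x ⁻¹ * x ≡ 1#
  ⁻¹-inverseˡ {x} x≢0 = trans (*-comm (x ⁻¹) x) (inverse x x≢0)

  *-cancelˡ : ∀ {x y z} → x ≢ 0# → x * y ≡ x * z → y ≡ z
  *-cancelˡ {x} {y} {z} x≢0 xy≡xz = begin
    y                 ≡⟨ sym (*-identityˡ y) ⟩
    1# * y            ≡⟨ cong (_* y) (sym (⁻¹-inverseˡ x≢0)) ⟩
    x ⁻¹ * x * y      ≡⟨ *-assoc (x ⁻¹) x y ⟩
    x ⁻¹ * (x * y)    ≡⟨ cong (x ⁻¹ *_) xy≡xz ⟩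
    x ⁻¹ * (x * z)    ≡⟨ sym (*-assoc (x ⁻¹) x z) ⟩
    x ⁻¹ * x * z      ≡⟨ cong (_* z) (⁻¹-inverseˡ x≢0) ⟩
    1# * z            ≡⟨ *-identityˡ z ⟩
    z                 ∎
    where open ≡-Reasoning

  *-≢0 : ∀ {x y} → x ≢ 0# → y ≢ 0# → x * y ≢ 0#
  *-≢0 {x} x≢0 y≢0 xy≡0 = y≢0 (*-cancelˡ x≢0 (trans xy≡0 (sym (zeroʳ x))))

  *≡1⇒≢0 : ∀ {x y} → x * y ≡ 1# → x ≢ 0#
  *≡1⇒≢0 {x} {y} xy≡1 x≡0 = 0≢1 (trans (sym (zeroˡ y)) (trans (cong (_* y) (sym x≡0)) xy≡1))

  ⁻¹-unique : ∀ {x y} → x * y ≡ 1# → x ⁻¹ ≡ y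
  ⁻¹-unique {x} xy≡1 = *-cancelˡ x≢0 (trans (inverse x x≢0) (sym xy≡1))
    where x≢0 = *≡1⇒≢0 xy≡1

  x-y≡0⇒x≡y : ∀ {x y} → x - y ≡ 0# → x ≡ y
  x-y≡0⇒x≡y {x} {y} x-y≡0 = trans (+-inverseˡ-unique x (- y) x-y≡0) (-‿involutive y)

  ^-+ : ∀ x m n → x ^ (m ℕ.+ n) ≡ x ^ m * x ^ n
  ^-+ x zero n = sym (*-identityˡ (x ^ n))
  ^-+ x (suc m) n = trans (cong (x *_) (^-+ x m n)) (sym (*-assoc x (x ^ m) (x ^ n)))

  ^-* : ∀ x m n → x ^ (m ℕ.* n) ≡ (x ^ m) ^ n
  ^-* x m zero = cong (x ^_) (ℕ.*-zeroʳ m)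
  ^-* x m (suc n) = begin
    x ^ (m ℕ.* suc n)        ≡⟨ cong (x ^_) (ℕ.*-suc m n) ⟩
    x ^ (m ℕ.+ m ℕ.* n)      ≡⟨ ^-+ x m (m ℕ.* n) ⟩
    x ^ m * x ^ (m ℕ.* n)    ≡⟨ cong (x ^ m *_) (^-* x m n) ⟩
    x ^ m * (x ^ m) ^ n      ∎
    where open ≡-Reasoning

  ^-distrib-* : ∀ x y n → (x * y) ^ n ≡ x ^ n * y ^ n
  ^-distrib-* x y zero = sym (*-identityˡ 1#)
  ^-distrib-* x y (suc n) = trans (cong ((x * y) *_) (^-distrib-* x y n))
    (solve 4 (λ x y xⁿ yⁿ → (x :* y) :* (xⁿ :* yⁿ) := (x :* xⁿ) :* (y :* yⁿ)) refl x y (x ^ n) (y ^ n))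

  1^n≡1 : ∀ n → 1# ^ n ≡ 1#
  1^n≡1 zero = refl
  1^n≡1 (suc n) = trans (*-identityˡ (1# ^ n)) (1^n≡1 n)

  ^-≢0 : ∀ {x} → x ≢ 0# → ∀ n → x ^ n ≢ 0#
  ^-≢0 x≢0 zero 1≡0 = 0≢1 (sym 1≡0)
  ^-≢0 x≢0 (suc n) = *-≢0 x≢0 (^-≢0 x≢0 n)

  ^-periodic : ∀ x n .{{_ : ℕ.NonZero n}} → x ^ n ≡ 1# → ∀ k → x ^ k ≡ x ^ (k % n)
  ^-periodic x n xⁿ≡1 k = begin
    x ^ k                                  ≡⟨ cong (x ^_) (m≡m%n+[m/n]*n k n) ⟩
    x ^ (k % n ℕ.+ k ℕ./ n ℕ.* n)          ≡⟨ ^-+ x (k % n) (k ℕ./ n ℕ.* n) ⟩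
    x ^ (k % n) * x ^ (k ℕ./ n ℕ.* n)      ≡⟨ cong (λ m → x ^ (k % n) * x ^ m) (ℕ.*-comm (k ℕ./ n) n) ⟩
    x ^ (k % n) * x ^ (n ℕ.* (k ℕ./ n))    ≡⟨ cong (x ^ (k % n) *_) (^-* x n (k ℕ./ n)) ⟩
    x ^ (k % n) * (x ^ n) ^ (k ℕ./ n)      ≡⟨ cong (λ y → x ^ (k % n) * y ^ (k ℕ./ n)) xⁿ≡1 ⟩
    x ^ (k % n) * 1# ^ (k ℕ./ n)           ≡⟨ cong (x ^ (k % n) *_) (1^n≡1 (k ℕ./ n)) ⟩
    x ^ (k % n) * 1#                       ≡⟨ *-identityʳ (x ^ (k % n)) ⟩
    x ^ (k % n)                            ∎
    where open ≡-Reasoning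

  ^-≡⇒^-∸≡1 : ∀ {x a b} → x ≢ 0# → a ≤ b → x ^ a ≡ x ^ b → x ^ (b ∸ a) ≡ 1#
  ^-≡⇒^-∸≡1 {x} {a} {b} x≢0 a≤b xᵃ≡xᵇ = *-cancelˡ (^-≢0 x≢0 a) (begin
    x ^ a * x ^ (b ∸ a)    ≡⟨ sym (^-+ x a (b ∸ a)) ⟩
    x ^ (a ℕ.+ (b ∸ a))    ≡⟨ cong (x ^_) (ℕ.m+[n∸m]≡n a≤b) ⟩
    x ^ b                  ≡⟨ sym xᵃ≡xᵇ ⟩
    x ^ a                  ≡⟨ sym (*-identityʳ (x ^ a)) ⟩
    x ^ a * 1#             ∎)
    where open ≡-Reasoning

  *≡1⇒^≡-1 : ∀ {x y} n → x * y ≡ 1# → x ^ n ≡ - 1# → y ^ n ≡ - 1#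
  *≡1⇒^≡-1 {x} {y} n xy≡1 xⁿ≡-1 = begin
    y ^ n                    ≡⟨ sym (-‿involutive (y ^ n)) ⟩
    - (- (y ^ n))            ≡⟨ cong -_ (sym (-1*x≈-x (y ^ n))) ⟩
    - (- 1# * y ^ n)         ≡⟨ cong (λ z → - (z * y ^ n)) (sym xⁿ≡-1) ⟩
    - (x ^ n * y ^ n)        ≡⟨ cong -_ (sym (^-distrib-* x y n)) ⟩
    - ((x * y) ^ n)          ≡⟨ cong (λ z → - (z ^ n)) xy≡1 ⟩
    - (1# ^ n)               ≡⟨ cong -_ (1^n≡1 n) ⟩
    - 1#                     ∎
    where open ≡-Reasoning

  surjection⇒q≤ : ∀ {k} (s : Fin k → Carrier) → (∀ x → ∃ λ i → s i ≡ x) → q ≤ k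
  surjection⇒q≤ s s-onto = injective⇒≤ {f = λ i → proj₁ (s-onto (to i))} λ {i} {j} eq →
    Injection.injective (↔⇒↣ enum) (trans (sym (proj₂ (s-onto (to i))))
      (trans (cong s eq) (proj₂ (s-onto (to j)))))

  infix 4 _≈±_
  _≈±_ : Carrier → Carrier → Set
  x ≈± y = x ≡ y ⊎ x ≡ - y

  ≈±-trans : ∀ {x y z} → x ≈± y → y ≈± z → x ≈± z
  ≈±-trans (inj₁ x≡y) (inj₁ y≡z) = inj₁ (trans x≡y y≡z)
  ≈±-trans (inj₁ x≡y) (inj₂ y≡-z) = inj₂ (trans x≡y y≡-z)
  ≈±-trans (inj₂ x≡-y) (inj₁ y≡z) = inj₂ (trans x≡-y (cong -_ y≡z))
  ≈±-trans (inj₂ x≡-y) (inj₂ y≡-z) = inj₁ (trans x≡-y (trans (cong -_ y≡-z) (-‿involutive _)))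

  ≈±-*ˡ : ∀ x {y z} → y ≈± z → x * y ≈± x * z
  ≈±-*ˡ x (inj₁ y≡z) = inj₁ (cong (x *_) y≡z)
  ≈±-*ˡ x (inj₂ y≡-z) = inj₂ (trans (cong (x *_) y≡-z) (sym (-‿distribʳ-* x _)))

  ≈±⇒square≡ : ∀ {x y} → x ≈± y → x * x ≡ y * y
  ≈±⇒square≡ {y = y} (inj₁ refl) = refl
  ≈±⇒square≡ {y = y} (inj₂ refl) = solve 1 (λ y → (:- y) :* (:- y) := y :* y) refl y

  cubic : (a₀ a₁ a₂ a₃ u : Carrier) → Carrier
  cubic a₀ a₁ a₂ a₃ u = a₃ * u ^ 3 + a₂ * u ^ 2 + a₁ * u + a₀

  quadrinomial : (d : ℕ) (a₀ a₁ a₂ a₃ x : Carrier) → Carrier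
  quadrinomial d a₀ a₁ a₂ a₃ x =
    a₃ * (x ^ (3 ℕ.* d ℕ.+ 1)) + a₂ * (x ^ (2 ℕ.* d ℕ.+ 1)) + a₁ * (x ^ (d ℕ.+ 1)) + a₀ * x

  InvolutionWithFixedPoints : (n d : ℕ) (a₀ a₁ a₂ a₃ : Carrier) → Set
  InvolutionWithFixedPoints n d a₀ a₁ a₂ a₃ =
    (∀ x → f (f x) ≡ x) × (Fin n ↔ Σ Carrier λ x → f x ≡ x)
    where
    f : Carrier → Carrier
    f = quadrinomial d a₀ a₁ a₂ a₃

  quadrinomial≡x*cubic : ∀ d a₀ a₁ a₂ a₃ x →
    quadrinomial d a₀ a₁ a₂ a₃ x ≡ x * cubic a₀ a₁ a₂ a₃ (x ^ d)
  quadrinomial≡x*cubic d a₀ a₁ a₂ a₃ x = begin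
    a₃ * x ^ (3 ℕ.* d ℕ.+ 1) + a₂ * x ^ (2 ℕ.* d ℕ.+ 1) + a₁ * x ^ (d ℕ.+ 1) + a₀ * x
      ≡⟨ cong₂ (λ y z → a₃ * y + a₂ * z + a₁ * x ^ (d ℕ.+ 1) + a₀ * x) (^-k*d+1 3) (^-k*d+1 2) ⟩
    a₃ * (u ^ 3 * x ^ 1) + a₂ * (u ^ 2 * x ^ 1) + a₁ * x ^ (d ℕ.+ 1) + a₀ * x
      ≡⟨ cong (λ y → a₃ * (u ^ 3 * x ^ 1) + a₂ * (u ^ 2 * x ^ 1) + a₁ * y + a₀ * x) (^-+ x d 1) ⟩
    a₃ * (u ^ 3 * x ^ 1) + a₂ * (u ^ 2 * x ^ 1) + a₁ * (u * x ^ 1) + a₀ * x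
      ≡⟨ solve 6 (λ a₀ a₁ a₂ a₃ u x →
           a₃ :* (u :^ 3 :* x :^ 1) :+ a₂ :* (u :^ 2 :* x :^ 1) :+ a₁ :* (u :* x :^ 1) :+ a₀ :* x
           := x :* (a₃ :* u :^ 3 :+ a₂ :* u :^ 2 :+ a₁ :* u :+ a₀)) refl a₀ a₁ a₂ a₃ u x ⟩
    x * cubic a₀ a₁ a₂ a₃ u ∎
    where
    open ≡-Reasoning
    u : Carrier
    u = x ^ d
    ^-k*d+1 : ∀ k → x ^ (k ℕ.* d ℕ.+ 1) ≡ u ^ k * x ^ 1
    ^-k*d+1 k = trans (^-+ x (k ℕ.* d) 1) (cong (_* x ^ 1) (trans (cong (x ^_) (ℕ.*-comm k d)) (^-* x d k)))

  cubic-at-√ : ∀ {u v} a₀ a₁ a₂ a₃ → u * u ≡ v →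
    cubic a₀ a₁ a₂ a₃ u ≡ (a₁ + a₃ * v) * u + (a₀ + a₂ * v)
  cubic-at-√ {u} {v} a₀ a₁ a₂ a₃ u²≡v = trans
    (solve 5 (λ a₀ a₁ a₂ a₃ u → a₃ :* u :^ 3 :+ a₂ :* u :^ 2 :+ a₁ :* u :+ a₀
                := (a₁ :+ a₃ :* (u :* u)) :* u :+ (a₀ :+ a₂ :* (u :* u))) refl a₀ a₁ a₂ a₃ u)
    (cong (λ w → (a₁ + a₃ * w) * u + (a₀ + a₂ * w)) u²≡v)

  x+[z-1]*y≡x : ∀ x y {z} → z ≡ 1# → x + (z - 1#) * y ≡ x
  x+[z-1]*y≡x x y refl = solve 2 (λ x y → x :+ (con (ℤ.+ 1) :- con (ℤ.+ 1)) :* y := x) refl x y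

  module Cyclic (g : Carrier) (g-generates : IsGenerator g) {n : ℕ} (q≡1+n : q ≡ suc n) where

    private
      g≢0 : g ≢ 0#
      g≢0 = proj₁ g-generates
      log : ∀ x → x ≢ 0# → ∃ λ k → g ^ k ≡ x
      log = proj₂ g-generates

    zeroAndPowers : ∀ m → Fin (suc m) → Carrier
    zeroAndPowers m Fin.zero = 0#
    zeroAndPowers m (Fin.suc j) = g ^ toℕ j

    order-≥ : ∀ {m} → 0 < m → g ^ m ≡ 1# → n ≤ m
    order-≥ {m} 0<m gᵐ≡1 = ℕ.s≤s⁻¹ (subst (_≤ suc m) q≡1+n (surjection⇒q≤ (zeroAndPowers m) onto))
      where
      instance
        m≢0 : ℕ.NonZero m
        m≢0 = ℕ.>-nonZero 0<m
      onto : ∀ x → ∃ λ i → zeroAndPowers m i ≡ x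
      onto x with x ≟ 0#
      ... | yes x≡0 = Fin.zero , sym x≡0
      ... | no x≢0 with k , gᵏ≡x ← log x x≢0 = Fin.suc (fromℕ< (m%n<n k m)) ,
            trans (cong (g ^_) (toℕ-fromℕ< (m%n<n k m))) (trans (sym (^-periodic g m gᵐ≡1 k)) gᵏ≡x)

    order : g ^ n ≡ 1#
    order with i , j , i<j , eq ← pigeonhole (ℕ.n<1+n q) (Inverse.from enum ∘′ zeroAndPowers q)
      = collision i j i<j (Injection.injective (↔⇒↣ (↔-sym enum)) eq)
      where
      collision : ∀ i j → i Fin.< j → zeroAndPowers q i ≡ zeroAndPowers q j → g ^ n ≡ 1#
      collision Fin.zero (Fin.suc b) _ 0≡gᵇ = ⊥-elim (^-≢0 g≢0 (toℕ b) (sym 0≡gᵇ))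
      collision (Fin.suc a) (Fin.suc b) (ℕ.s≤s a<b) gᵃ≡gᵇ = subst (λ k → g ^ k ≡ 1#) b-a≡n gᵇ⁻ᵃ≡1
        where
        b≤n : toℕ b ≤ n
        b≤n = ℕ.s≤s⁻¹ (subst (toℕ b <_) q≡1+n (toℕ<n b))
        gᵇ⁻ᵃ≡1 : g ^ (toℕ b ∸ toℕ a) ≡ 1#
        gᵇ⁻ᵃ≡1 = ^-≡⇒^-∸≡1 g≢0 (ℕ.<⇒≤ a<b) gᵃ≡gᵇ
        b-a≡n : toℕ b ∸ toℕ a ≡ n
        b-a≡n = ℕ.≤-antisym (ℕ.≤-trans (ℕ.m∸n≤m (toℕ b) (toℕ a)) b≤n)
                            (order-≥ (ℕ.m<n⇒0<n∸m a<b) gᵇ⁻ᵃ≡1)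

    ^-distinct : ∀ {a b} → a < b → b < n → g ^ a ≢ g ^ b
    ^-distinct {a} {b} a<b b<n gᵃ≡gᵇ = ℕ.<⇒≱ (ℕ.≤-<-trans (ℕ.m∸n≤m b a) b<n)
      (order-≥ (ℕ.m<n⇒0<n∸m a<b) (^-≡⇒^-∸≡1 g≢0 (ℕ.<⇒≤ a<b) gᵃ≡gᵇ))

    ^-injective : ∀ {a b} → a < n → b < n → g ^ a ≡ g ^ b → a ≡ b
    ^-injective {a} {b} a<n b<n gᵃ≡gᵇ with ℕ.<-cmp a b
    ... | tri< a<b _ _ = ⊥-elim (^-distinct a<b b<n gᵃ≡gᵇ)
    ... | tri≈ _ a≡b _ = a≡b
    ... | tri> _ _ b<a = ⊥-elim (^-distinct b<a a<n (sym gᵃ≡gᵇ))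

    discrete-log : .{{_ : ℕ.NonZero n}} → ∀ {x} → x ≢ 0# → ∃ λ k → k < n × g ^ k ≡ x
    discrete-log {x} x≢0 with k , gᵏ≡x ← log x x≢0 =
      k % n , m%n<n k n , trans (sym (^-periodic g n order k)) gᵏ≡x

  module FourthRoots (g : Carrier) (g-generates : IsGenerator g)
                     (d : ℕ) .{{_ : ℕ.NonZero d}} (q≡1+4d : q ≡ suc (4 ℕ.* d)) where

    instance
      4d≢0 : ℕ.NonZero (4 ℕ.* d)
      4d≢0 = ℕ.m*n≢0 4 d

    open Cyclic g g-generates q≡1+4d

    ω : Carrier
    ω = g ^ d

    ^d-of-power : ∀ k → (g ^ k) ^ d ≡ ω ^ k
    ^d-of-power k = trans (sym (^-* g k d)) (trans (cong (g ^_) (ℕ.*-comm k d)) (^-* g d k))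

    ω*ω≢1 : ω * ω ≢ 1#
    ω*ω≢1 ω²≡1 = ℕ.<⇒≱ 2d<4d (order-≥ (ℕ.>-nonZero⁻¹ (d ℕ.* 2)) g^[2d]≡1)
      where
      instance
        2d≢0 : ℕ.NonZero (d ℕ.* 2)
        2d≢0 = ℕ.m*n≢0 d 2
      2d<4d : d ℕ.* 2 < 4 ℕ.* d
      2d<4d = subst (d ℕ.* 2 <_) (ℕ.*-comm d 4) (ℕ.*-monoʳ-< d (ℕ.s≤s (ℕ.s≤s (ℕ.s≤s ℕ.z≤n))))
      g^[2d]≡1 : g ^ (d ℕ.* 2) ≡ 1#
      g^[2d]≡1 = trans (^-* g d 2) (trans (cong (ω *_) (*-identityʳ ω)) ω²≡1)

    ω⁴≡1 : ω ^ 4 ≡ 1#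
    ω⁴≡1 = trans (sym (^-* g d 4)) (trans (cong (g ^_) (ℕ.*-comm d 4)) order)

    ω*ω≡-1 : ω * ω ≡ - 1#
    ω*ω≡-1 with (ω * ω + 1#) ≟ 0#
    ... | yes ω²+1≡0 = +-inverseˡ-unique (ω * ω) 1# ω²+1≡0
    ... | no ω²+1≢0 = ⊥-elim (*-≢0 (ω*ω≢1 ∘′ x-y≡0⇒x≡y) ω²+1≢0 (begin
      ((ω * ω) - 1#) * (ω * ω + 1#) ≡⟨ solve 1 (λ w → (w :* w :- con (ℤ.+ 1)) :* (w :* w :+ con (ℤ.+ 1))
                                                     := w :^ 4 :- con (ℤ.+ 1)) refl ω ⟩
      (ω ^ 4) - 1#                  ≡⟨ cong (_- 1#) ω⁴≡1 ⟩
      1# - 1#                       ≡⟨ -‿inverseʳ 1# ⟩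
      0#                            ∎))
      where open ≡-Reasoning

    -1≢1 : - 1# ≢ 1#
    -1≢1 -1≡1 = ω*ω≢1 (trans ω*ω≡-1 -1≡1)

    4#≢0 : 4# ≢ 0#
    4#≢0 4≡0 = *-≢0 2≢0 2≢0 (trans (solve 0 (con (ℤ.+ 2) :* con (ℤ.+ 2) := con (ℤ.+ 4)) refl) 4≡0)
      where
      2≢0 : 1# + 1# ≢ 0#
      2≢0 2≡0 = -1≢1 (sym (+-inverseˡ-unique 1# 1# 2≡0))

    ω^[2+k]≡-ω^k : ∀ k → ω ^ (2 ℕ.+ k) ≡ - ω ^ k
    ω^[2+k]≡-ω^k k = begin
      ω * (ω * ω ^ k)    ≡⟨ sym (*-assoc ω ω (ω ^ k)) ⟩
      ω * ω * ω ^ k      ≡⟨ cong (_* ω ^ k) ω*ω≡-1 ⟩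
      - 1# * ω ^ k       ≡⟨ -1*x≈-x (ω ^ k) ⟩
      - ω ^ k            ∎
      where open ≡-Reasoning

    ω^[k*2]≈±1 : ∀ k → ω ^ (k ℕ.* 2) ≈± 1#
    ω^[k*2]≈±1 zero = inj₁ refl
    ω^[k*2]≈±1 (suc k) = ≈±-trans (inj₂ (ω^[2+k]≡-ω^k (k ℕ.* 2))) (ω^[k*2]≈±1 k)

    ω^[r+k*2]≈±ω^r : ∀ r k → ω ^ (r ℕ.+ k ℕ.* 2) ≈± ω ^ r
    ω^[r+k*2]≈±ω^r r k = subst₂ _≈±_ (sym (^-+ ω r (k ℕ.* 2))) (*-identityʳ (ω ^ r))
      (≈±-*ˡ (ω ^ r) (ω^[k*2]≈±1 k))

    ω^r≈±ω^[1+t] : ∀ {r t} → r < 2 → t < 2 → r ≢ t → ω ^ r ≈± ω ^ suc t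
    ω^r≈±ω^[1+t] {0} {0} _ _ 0≢0 = ⊥-elim (0≢0 refl)
    ω^r≈±ω^[1+t] {0} {1} _ _ _ =
      inj₂ (sym (trans (cong -_ (ω^[2+k]≡-ω^k 0)) (-‿involutive 1#)))
    ω^r≈±ω^[1+t] {1} {0} _ _ _ = inj₁ refl
    ω^r≈±ω^[1+t] {1} {1} _ _ 1≢1 = ⊥-elim (1≢1 refl)
    ω^r≈±ω^[1+t] {suc (suc _)} (ℕ.s≤s (ℕ.s≤s ())) _ _
    ω^r≈±ω^[1+t] {_} {suc (suc _)} _ (ℕ.s≤s (ℕ.s≤s ())) _

    [g^k]^d≈±ω^[k%2] : ∀ k → (g ^ k) ^ d ≈± ω ^ (k % 2)
    [g^k]^d≈±ω^[k%2] k = ≈±-trans (inj₁ (^d-of-power k))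
      (subst (λ m → ω ^ m ≈± ω ^ (k % 2)) (sym (m≡m%n+[m/n]*n k 2)) (ω^[r+k*2]≈±ω^r (k % 2) (k ℕ./ 2)))

    ^d-parity : ∀ {t} → t < 2 → ∀ k → k % 2 ≡ t ⊎ (g ^ k) ^ d ≈± ω ^ suc t
    ^d-parity {t} t<2 k with k % 2 ℕ.≟ t
    ... | yes k%2≡t = inj₁ k%2≡t
    ... | no k%2≢t = inj₂ (≈±-trans ([g^k]^d≈±ω^[k%2] k) (ω^r≈±ω^[1+t] (m%n<n k 2) t<2 k%2≢t))

    ω^1*ω^1≡-1 : ω ^ 1 * ω ^ 1 ≡ - 1#
    ω^1*ω^1≡-1 = trans (cong₂ _*_ (*-identityʳ ω) (*-identityʳ ω)) ω*ω≡-1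

    module Involution (a₀ a₁ a₂ a₃ : Carrier) {t : ℕ} (t<2 : t < 2)
      (fixed-class : ∀ {u} → u ≈± ω ^ t → cubic a₀ a₁ a₂ a₃ u ≡ 1#)
      {h c : Carrier} (cubic[ω^[1+t]]≡h : cubic a₀ a₁ a₂ a₃ (ω ^ suc t) ≡ h)
      (cubic[-ω^[1+t]]≡c : cubic a₀ a₁ a₂ a₃ (- ω ^ suc t) ≡ c)
      (h*c≡1 : h * c ≡ 1#) (h^d≡-1 : h ^ d ≡ - 1#) where

      P : Carrier → Carrier
      P = cubic a₀ a₁ a₂ a₃

      f : Carrier → Carrier
      f = quadrinomial d a₀ a₁ a₂ a₃

      f≡x*P[x^d] : ∀ x → f x ≡ x * P (x ^ d)
      f≡x*P[x^d] = quadrinomial≡x*cubic d a₀ a₁ a₂ a₃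

      f0≡0 : f 0# ≡ 0#
      f0≡0 = trans (f≡x*P[x^d] 0#) (zeroˡ _)

      moving-class : ∀ {u} → u ≈± ω ^ suc t → P u * P (- u) ≡ 1# × P u ^ d ≡ - 1#
      moving-class (inj₁ refl) rewrite cubic[ω^[1+t]]≡h | cubic[-ω^[1+t]]≡c = h*c≡1 , h^d≡-1
      moving-class (inj₂ refl) rewrite -‿involutive (ω ^ suc t) | cubic[ω^[1+t]]≡h | cubic[-ω^[1+t]]≡c =
        trans (*-comm c h) h*c≡1 , *≡1⇒^≡-1 d h*c≡1 h^d≡-1

      fixed-or-moving : ∀ {x} → x ≢ 0# → x ^ d ≈± ω ^ t ⊎ x ^ d ≈± ω ^ suc t
      fixed-or-moving x≢0 with k , _ , refl ← discrete-log x≢0 with ^d-parity t<2 k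
      ... | inj₁ k%2≡t = inj₁ (subst (λ r → _ ≈± ω ^ r) k%2≡t ([g^k]^d≈±ω^[k%2] k))
      ... | inj₂ moving = inj₂ moving

      fixes : ∀ {x} → x ^ d ≈± ω ^ t → f x ≡ x
      fixes {x} x^d≈±ω^t = trans (f≡x*P[x^d] x) (trans (cong (x *_) (fixed-class x^d≈±ω^t)) (*-identityʳ x))

      -- f multiplies x by P u, which turns x^d = u into -u as (P u)^d = -1; then it multiplies by P (-u)
      swaps : ∀ {x u} → x ^ d ≡ u → P u * P (- u) ≡ 1# × P u ^ d ≡ - 1# → f (f x) ≡ x
      swaps {x} {u} x^d≡u (PuP[-u]≡1 , Pu^d≡-1) = begin
        f (f x)                        ≡⟨ cong f fx≡x*Pu ⟩
        f (x * P u)                    ≡⟨ f≡x*P[x^d] (x * P u) ⟩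
        x * P u * P ((x * P u) ^ d)    ≡⟨ cong (λ y → x * P u * P y) [x*Pu]^d≡-u ⟩
        x * P u * P (- u)              ≡⟨ *-assoc x (P u) (P (- u)) ⟩
        x * (P u * P (- u))            ≡⟨ cong (x *_) PuP[-u]≡1 ⟩
        x * 1#                         ≡⟨ *-identityʳ x ⟩
        x                              ∎
        where
        open ≡-Reasoning
        fx≡x*Pu : f x ≡ x * P u
        fx≡x*Pu = trans (f≡x*P[x^d] x) (cong (λ y → x * P y) x^d≡u)
        [x*Pu]^d≡-u : (x * P u) ^ d ≡ - u
        [x*Pu]^d≡-u = begin
          (x * P u) ^ d       ≡⟨ ^-distrib-* x (P u) d ⟩
          x ^ d * P u ^ d     ≡⟨ cong₂ _*_ x^d≡u Pu^d≡-1 ⟩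
          u * - 1#            ≡⟨ solve 1 (λ u → u :* (:- con (ℤ.+ 1)) := :- u) refl u ⟩
          - u                 ∎

      involutive : ∀ x → f (f x) ≡ x
      involutive x with x ≟ 0#
      ... | yes refl = trans (cong f f0≡0) f0≡0
      ... | no x≢0 with fixed-or-moving x≢0
      ... | inj₁ fixed = trans (cong f (fixes fixed)) (fixes fixed)
      ... | inj₂ moving = swaps refl (moving-class moving)

      moving-not-fixed : ∀ {x} → x ≢ 0# → x ^ d ≈± ω ^ suc t → f x ≢ x
      moving-not-fixed {x} x≢0 moving fx≡x = -1≢1 (begin
        - 1#              ≡⟨ sym (proj₂ (moving-class moving)) ⟩
        P (x ^ d) ^ d     ≡⟨ cong (_^ d) P[x^d]≡1 ⟩
        1# ^ d            ≡⟨ 1^n≡1 d ⟩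
        1#                ∎)
        where
        open ≡-Reasoning
        P[x^d]≡1 : P (x ^ d) ≡ 1#
        P[x^d]≡1 = *-cancelˡ x≢0 (trans (sym (f≡x*P[x^d] x)) (trans fx≡x (sym (*-identityʳ x))))

      enumerate : Fin (suc (2 ℕ.* d)) → Carrier
      enumerate Fin.zero = 0#
      enumerate (Fin.suc j) = g ^ (t ℕ.+ toℕ j ℕ.* 2)

      enumerate-fixed : ∀ i → f (enumerate i) ≡ enumerate i
      enumerate-fixed Fin.zero = f0≡0
      enumerate-fixed (Fin.suc j) =
        fixes (≈±-trans (inj₁ (^d-of-power (t ℕ.+ toℕ j ℕ.* 2))) (ω^[r+k*2]≈±ω^r t (toℕ j)))

      enumerate-injective : Injective _≡_ _≡_ enumerate
      enumerate-injective {Fin.zero} {Fin.zero} _ = refl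
      enumerate-injective {Fin.zero} {Fin.suc j} 0≡g^k = ⊥-elim (^-≢0 (proj₁ g-generates) (t ℕ.+ toℕ j ℕ.* 2) (sym 0≡g^k))
      enumerate-injective {Fin.suc i} {Fin.zero} g^k≡0 = ⊥-elim (^-≢0 (proj₁ g-generates) (t ℕ.+ toℕ i ℕ.* 2) g^k≡0)
      enumerate-injective {Fin.suc i} {Fin.suc j} g^k≡g^l = cong Fin.suc (toℕ-injective
        (ℕ.*-cancelʳ-≡ (toℕ i) (toℕ j) 2 (ℕ.+-cancelˡ-≡ t _ _
          (^-injective (exponent<4d i) (exponent<4d j) g^k≡g^l))))
        where
        exponent<4d : ∀ j → t ℕ.+ toℕ j ℕ.* 2 < 4 ℕ.* d
        exponent<4d j = subst (t ℕ.+ toℕ j ℕ.* 2 <_) (2*d*2≡4*d d) (n+j*2<m*2 t<2 (toℕ<n j))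

      enumerate-covers : ∀ x → f x ≡ x → ∃ λ i → enumerate i ≡ x
      enumerate-covers x fx≡x with x ≟ 0#
      ... | yes x≡0 = Fin.zero , sym x≡0
      ... | no x≢0 with k , k<4d , refl ← discrete-log x≢0 with ^d-parity t<2 k
      ...   | inj₁ k%2≡t = Fin.suc (fromℕ< k/2<2d) , cong (g ^_) (begin
              t ℕ.+ toℕ (fromℕ< k/2<2d) ℕ.* 2   ≡⟨ cong (λ j → t ℕ.+ j ℕ.* 2) (toℕ-fromℕ< k/2<2d) ⟩
              t ℕ.+ k ℕ./ 2 ℕ.* 2               ≡⟨ cong (ℕ._+ k ℕ./ 2 ℕ.* 2) (sym k%2≡t) ⟩
              k % 2 ℕ.+ k ℕ./ 2 ℕ.* 2           ≡⟨ sym (m≡m%n+[m/n]*n k 2) ⟩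
              k                                 ∎)
        where
        open ≡-Reasoning
        k/2<2d : k ℕ./ 2 < 2 ℕ.* d
        k/2<2d = m<n*o⇒m/o<n (subst (k <_) (sym (2*d*2≡4*d d)) k<4d)
      ...   | inj₂ moving = ⊥-elim (moving-not-fixed x≢0 moving fx≡x)

      fixed-points : Fin (suc (2 ℕ.* d)) ↔ Σ Carrier λ x → f x ≡ x
      fixed-points = enumeration⇒↔ enumerate enumerate-injective enumerate-fixed enumerate-covers
        (UIP.Decidable⇒UIP.≡-irrelevant _≟_)

      involutionWithFixedPoints : InvolutionWithFixedPoints (suc (2 ℕ.* d)) d a₀ a₁ a₂ a₃
      involutionWithFixedPoints = involutive , fixed-points

    -- Family (a) takes t = 1, so its fixed points are 0 and the non-squares;
    -- family (b) takes t = 0, so they are 0 and the nonzero squares.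
    module Families (i : ℕ) where

      private
        #_ : ∀ {n} → ℕ → Polynomial n
        # k = con (ℤ.+ k)

        cubicᵖ : ∀ {n} (a₀ a₁ a₂ a₃ u : Polynomial n) → Polynomial n
        cubicᵖ a₀ a₁ a₂ a₃ u = a₃ :* u :^ 3 :+ a₂ :* u :^ 2 :+ a₁ :* u :+ a₀

        A₀ᵖ A₁ᵖ A₂ᵖ : ∀ {n} (h e : Polynomial n) → Polynomial n
        A₀ᵖ h e = (h :+ # 1) :^ 2 :* e
        A₁ᵖ h e = (h :* h :- # 1) :* e
        A₂ᵖ h e = (h :- # 1) :^ 2 :* e

      E : ℕ
      E = 4 ℕ.* i ℕ.+ 2

      h e e′ : Carrier
      h = g ^ E
      e = (4# * h) ⁻¹
      e′ = (4# * (g ^ (d ℕ.+ 4 ℕ.* i ℕ.+ 2))) ⁻¹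

      a₀ a₁ᵃ a₂ᵃ a₁ᵇ A₁ : Carrier
      a₀ = ((h + 1#) ^ 2) / (4# * h)
      a₁ᵃ = ((g ^ (2 ℕ.* E)) - 1#) / (4# * h)
      a₂ᵃ = ((h - 1#) ^ 2) / (4# * h)
      a₁ᵇ = ((g ^ (2 ℕ.* E)) - 1#) / (4# * (g ^ (d ℕ.+ 4 ℕ.* i ℕ.+ 2)))
      A₁ = ((h * h) - 1#) * e

      4he≡1 : 4# * h * e ≡ 1#
      4he≡1 = inverse (4# * h) (*-≢0 4#≢0 (^-≢0 (proj₁ g-generates) E))

      h*4e≡1 : h * (4# * e) ≡ 1#
      h*4e≡1 = trans (solve 2 (λ h e → h :* (# 4 :* e) := # 4 :* h :* e) refl h e) 4he≡1

      h^d≡-1 : h ^ d ≡ - 1#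
      h^d≡-1 = begin
        h ^ d                   ≡⟨ ^d-of-power E ⟩
        ω ^ (4 ℕ.* i ℕ.+ 2)     ≡⟨ cong (ω ^_) (ℕ.+-comm (4 ℕ.* i) 2) ⟩
        ω ^ (2 ℕ.+ 4 ℕ.* i)     ≡⟨ ω^[2+k]≡-ω^k (4 ℕ.* i) ⟩
        - ω ^ (4 ℕ.* i)         ≡⟨ cong -_ (^-* ω 4 i) ⟩
        - (ω ^ 4) ^ i           ≡⟨ cong (λ y → - y ^ i) ω⁴≡1 ⟩
        - 1# ^ i                ≡⟨ cong -_ (1^n≡1 i) ⟩
        - 1#                    ∎
        where open ≡-Reasoning

      g^[2E]≡h*h : g ^ (2 ℕ.* E) ≡ h * h
      g^[2E]≡h*h = trans (^-+ g E (E ℕ.+ 0)) (cong (λ k → h * g ^ k) (ℕ.+-identityʳ E))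

      a₁ᵃ≡A₁ : a₁ᵃ ≡ A₁
      a₁ᵃ≡A₁ = cong (λ y → (y - 1#) * e) g^[2E]≡h*h

      ω*e′≡e : ω * e′ ≡ e
      ω*e′≡e = sym (⁻¹-unique (begin
        4# * h * (ω * e′)                     ≡⟨ solve 3 (λ h w e′ → # 4 :* h :* (w :* e′) := # 4 :* (w :* h) :* e′) refl h ω e′ ⟩
        4# * (ω * h) * e′                     ≡⟨ cong (λ y → 4# * y * e′) (sym g^[d+E]≡ω*h) ⟩
        4# * (g ^ (d ℕ.+ 4 ℕ.* i ℕ.+ 2)) * e′  ≡⟨ inverse _ (*-≢0 4#≢0 (^-≢0 (proj₁ g-generates) (d ℕ.+ 4 ℕ.* i ℕ.+ 2))) ⟩
        1#                                    ∎))
        where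
        open ≡-Reasoning
        g^[d+E]≡ω*h : g ^ (d ℕ.+ 4 ℕ.* i ℕ.+ 2) ≡ ω * h
        g^[d+E]≡ω*h = trans (cong (g ^_) (ℕ.+-assoc d (4 ℕ.* i) 2)) (^-+ g d E)

      a₁ᵇ*ω≡A₁ : a₁ᵇ * ω ≡ A₁
      a₁ᵇ*ω≡A₁ = begin
        ((g ^ (2 ℕ.* E)) - 1#) * e′ * ω      ≡⟨ *-assoc _ e′ ω ⟩
        ((g ^ (2 ℕ.* E)) - 1#) * (e′ * ω)    ≡⟨ cong₂ (λ y z → (y - 1#) * z) g^[2E]≡h*h (trans (*-comm e′ ω) ω*e′≡e) ⟩
        ((h * h) - 1#) * e                   ∎
        where open ≡-Reasoning

      Pᵃ : Carrier → Carrier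
      Pᵃ = cubic a₀ A₁ a₂ᵃ A₁

      Pᵃ-fixed : ∀ {u} → u ≈± ω ^ 1 → Pᵃ u ≡ 1#
      Pᵃ-fixed {u} u≈±ω = begin
        Pᵃ u                                             ≡⟨ cubic-at-√ a₀ A₁ a₂ᵃ A₁ (trans (≈±⇒square≡ u≈±ω) ω^1*ω^1≡-1) ⟩
        (A₁ + A₁ * - 1#) * u + (a₀ + a₂ᵃ * - 1#)         ≡⟨ solve 3 (λ h e u →
              (A₁ᵖ h e :+ A₁ᵖ h e :* :- # 1) :* u :+ (A₀ᵖ h e :+ A₂ᵖ h e :* :- # 1) := # 4 :* h :* e) refl h e u ⟩
        4# * h * e                                       ≡⟨ 4he≡1 ⟩
        1#                                               ∎
        where open ≡-Reasoning

      Pᵃ[ω^2]≡4e : Pᵃ (ω ^ 2) ≡ 4# * e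
      Pᵃ[ω^2]≡4e = trans (cong Pᵃ (ω^[2+k]≡-ω^k 0)) (solve 2 (λ h e →
        cubicᵖ (A₀ᵖ h e) (A₁ᵖ h e) (A₂ᵖ h e) (A₁ᵖ h e) (:- # 1) := # 4 :* e) refl h e)

      Pᵃ[-ω^2]≡h : Pᵃ (- ω ^ 2) ≡ h
      Pᵃ[-ω^2]≡h = begin
        Pᵃ (- ω ^ 2)                  ≡⟨ cong Pᵃ (trans (cong -_ (ω^[2+k]≡-ω^k 0)) (-‿involutive 1#)) ⟩
        Pᵃ 1#                         ≡⟨ solve 2 (λ h e → cubicᵖ (A₀ᵖ h e) (A₁ᵖ h e) (A₂ᵖ h e) (A₁ᵖ h e) (# 1)
                                             := h :+ (# 4 :* h :* e :- # 1) :* h) refl h e ⟩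
        h + ((4# * h * e) - 1#) * h   ≡⟨ x+[z-1]*y≡x h h 4he≡1 ⟩
        h                             ∎
        where open ≡-Reasoning

      family-a : InvolutionWithFixedPoints (suc (2 ℕ.* d)) d a₀ a₁ᵃ a₂ᵃ a₁ᵃ
      family-a = subst (λ a₁ → InvolutionWithFixedPoints (suc (2 ℕ.* d)) d a₀ a₁ a₂ᵃ a₁) (sym a₁ᵃ≡A₁)
        (Involution.involutionWithFixedPoints a₀ A₁ a₂ᵃ A₁ {t = 1} (ℕ.s≤s (ℕ.s≤s ℕ.z≤n))
          Pᵃ-fixed Pᵃ[ω^2]≡4e Pᵃ[-ω^2]≡h (trans (*-comm (4# * e) h) h*4e≡1) (*≡1⇒^≡-1 d h*4e≡1 h^d≡-1))

      Pᵇ : Carrier → Carrier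
      Pᵇ = cubic a₀ a₁ᵇ (1# - a₀) (- a₁ᵇ)

      Pᵇ-fixed : ∀ {u} → u ≈± ω ^ 0 → Pᵇ u ≡ 1#
      Pᵇ-fixed {u} u≈±1 = begin
        Pᵇ u                                                          ≡⟨ cubic-at-√ a₀ a₁ᵇ (1# - a₀) (- a₁ᵇ) (≈±⇒square≡ u≈±1) ⟩
        (a₁ᵇ + - a₁ᵇ * (1# * 1#)) * u + (a₀ + (1# - a₀) * (1# * 1#))  ≡⟨ solve 3 (λ a₁ a₀ u →
            (a₁ :+ :- a₁ :* (# 1 :* # 1)) :* u :+ (a₀ :+ (# 1 :- a₀) :* (# 1 :* # 1)) := # 1) refl a₁ᵇ a₀ u ⟩
        1#                                                            ∎
        where open ≡-Reasoning

      Pᵇ-at-√-1 : ∀ {u} → u * u ≡ - 1# → Pᵇ u ≡ (a₁ᵇ * u + a₁ᵇ * u) + ((a₀ + a₀) - 1#)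
      Pᵇ-at-√-1 {u} u²≡-1 = trans (cubic-at-√ a₀ a₁ᵇ (1# - a₀) (- a₁ᵇ) u²≡-1) (solve 3 (λ a₁ a₀ u →
        (a₁ :+ :- a₁ :* :- # 1) :* u :+ (a₀ :+ (# 1 :- a₀) :* :- # 1) := (a₁ :* u :+ a₁ :* u) :+ ((a₀ :+ a₀) :- # 1))
        refl a₁ᵇ a₀ u)

      Pᵇ[ω^1]≡h : Pᵇ (ω ^ 1) ≡ h
      Pᵇ[ω^1]≡h = begin
        Pᵇ (ω ^ 1)                            ≡⟨ cong Pᵇ (*-identityʳ ω) ⟩
        Pᵇ ω                                  ≡⟨ Pᵇ-at-√-1 ω*ω≡-1 ⟩
        a₁ᵇ * ω + a₁ᵇ * ω + ((a₀ + a₀) - 1#)  ≡⟨ cong (λ y → y + y + ((a₀ + a₀) - 1#)) a₁ᵇ*ω≡A₁ ⟩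
        A₁ + A₁ + ((a₀ + a₀) - 1#)            ≡⟨ solve 2 (λ h e → A₁ᵖ h e :+ A₁ᵖ h e :+ ((A₀ᵖ h e :+ A₀ᵖ h e) :- # 1)
                                                     := h :+ (# 4 :* h :* e :- # 1) :* (h :+ # 1)) refl h e ⟩
        h + ((4# * h * e) - 1#) * (h + 1#)    ≡⟨ x+[z-1]*y≡x h (h + 1#) 4he≡1 ⟩
        h                                     ∎
        where open ≡-Reasoning

      Pᵇ[-ω^1]≡4e : Pᵇ (- ω ^ 1) ≡ 4# * e
      Pᵇ[-ω^1]≡4e = begin
        Pᵇ (- ω ^ 1)                                    ≡⟨ cong (λ y → Pᵇ (- y)) (*-identityʳ ω) ⟩
        Pᵇ (- ω)                                        ≡⟨ Pᵇ-at-√-1 (trans (≈±⇒square≡ (inj₂ refl)) ω*ω≡-1) ⟩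
        a₁ᵇ * - ω + a₁ᵇ * - ω + ((a₀ + a₀) - 1#)        ≡⟨ solve 3 (λ a₁ w c → a₁ :* :- w :+ a₁ :* :- w :+ c
                                                               := :- (a₁ :* w :+ a₁ :* w) :+ c) refl a₁ᵇ ω ((a₀ + a₀) - 1#) ⟩
        - (a₁ᵇ * ω + a₁ᵇ * ω) + ((a₀ + a₀) - 1#)        ≡⟨ cong (λ y → - (y + y) + ((a₀ + a₀) - 1#)) a₁ᵇ*ω≡A₁ ⟩
        - (A₁ + A₁) + ((a₀ + a₀) - 1#)                  ≡⟨ solve 2 (λ h e → :- (A₁ᵖ h e :+ A₁ᵖ h e) :+ ((A₀ᵖ h e :+ A₀ᵖ h e) :- # 1)
                                                               := # 4 :* e :+ (# 4 :* h :* e :- # 1) :* # 1) refl h e ⟩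
        4# * e + ((4# * h * e) - 1#) * 1#               ≡⟨ x+[z-1]*y≡x (4# * e) 1# 4he≡1 ⟩
        4# * e                                          ∎
        where open ≡-Reasoning

      family-b : InvolutionWithFixedPoints (suc (2 ℕ.* d)) d a₀ a₁ᵇ (1# - a₀) (- a₁ᵇ)
      family-b = Involution.involutionWithFixedPoints a₀ a₁ᵇ (1# - a₀) (- a₁ᵇ) {t = 0} (ℕ.s≤s ℕ.z≤n)
        Pᵇ-fixed Pᵇ[ω^1]≡h Pᵇ[-ω^1]≡4e h*4e≡1 h^d≡-1

theorem3 : (F : FiniteField) → let open FiniteField F in
    q % 4 ≡ 1 →
    (g : Carrier) → IsGenerator g →
    let d = (q ℕ.∸ 1) ℕ./ 4 in
    (i : ℕ) → i < d →
    let h = g ^ (4 ℕ.* i ℕ.+ 2) in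
    (a₀ a₁ a₂ a₃ : Carrier) →
    ((a₀ ≡ ((h + 1#) ^ 2) / (4# * h)) × (a₁ ≡ ((g ^ (2 ℕ.* (4 ℕ.* i ℕ.+ 2))) - 1#) / (4# * h))
       × (a₂ ≡ ((h - 1#) ^ 2) / (4# * h)) × (a₃ ≡ a₁))
    ⊎ ((a₀ ≡ ((h + 1#) ^ 2) / (4# * h)) × (a₁ ≡ ((g ^ (2 ℕ.* (4 ℕ.* i ℕ.+ 2))) - 1#) / (4# * (g ^ (d ℕ.+ 4 ℕ.* i ℕ.+ 2))))
       × (a₂ ≡ 1# - a₀) × (a₃ ≡ - a₁)) →
    let f : Carrier → Carrier
        f x = a₃ * (x ^ (3 ℕ.* d ℕ.+ 1)) + a₂ * (x ^ (2 ℕ.* d ℕ.+ 1)) + a₁ * (x ^ (d ℕ.+ 1)) + a₀ * x in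
    ((x : Carrier) → f (f x) ≡ x)
    × (Fin ((q ℕ.+ 1) ℕ./ 2) ↔ Σ Carrier (λ x → f x ≡ x))
theorem3 F q%4≡1 g g-generates i i<d a₀ a₁ a₂ a₃ coefficients =
  subst (λ n → InvolutionWithFixedPoints n d a₀ a₁ a₂ a₃) (sym [q+1]/2≡1+2d) (family coefficients)
  where
  open FiniteField F
  open FiniteFieldProperties F
  d : ℕ
  d = (q ∸ 1) ℕ./ 4
  q≡1+4d : q ≡ suc (4 ℕ.* d)
  q≡1+4d = m%4≡1⇒m≡1+4*[m∸1]/4 q q%4≡1
  instance
    d≢0 : ℕ.NonZero d
    d≢0 = ℕ.>-nonZero (ℕ.≤-<-trans ℕ.z≤n i<d)
  open FourthRoots g g-generates d q≡1+4d
  module C = Families i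
  [q+1]/2≡1+2d : (q ℕ.+ 1) ℕ./ 2 ≡ suc (2 ℕ.* d)
  [q+1]/2≡1+2d = trans (cong (λ n → (n ℕ.+ 1) ℕ./ 2) q≡1+4d) ([1+4d+1]/2≡1+2d d)
  family : ∀ {b₀ b₁ b₂ b₃} →
    (b₀ ≡ C.a₀ × b₁ ≡ C.a₁ᵃ × b₂ ≡ C.a₂ᵃ × b₃ ≡ b₁) ⊎ (b₀ ≡ C.a₀ × b₁ ≡ C.a₁ᵇ × b₂ ≡ 1# - b₀ × b₃ ≡ - b₁) →
    InvolutionWithFixedPoints (suc (2 ℕ.* d)) d b₀ b₁ b₂ b₃
  family (inj₁ (refl , refl , refl , refl)) = C.family-a
  family (inj₂ (refl , refl , refl , refl)) = C.family-b
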